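{- (i) If $q=2$ and $m\geq 3$ is odd, then $C=W([m/2],2)$ in $H(m,2)$ has covering radius $\rho=(m-1)/2$ and $C_\rho=\mathrm{Rep}(m,2)$; furthermore $C$ and $C_\rho$ are completely transitive. (ii) If $m=pq$ for a positive integer $p$ (and $m,q\geq 2$), then $C=\mathrm{All}(pq,q)$ in $H(pq,q)$ has covering radius $\rho=p(q-1)$ and $C_\rho=\mathrm{Rep}(m,q)$.
   Context: $H(m,q)$ is the Hamming graph on $Q^m$, $|Q|=q$, with Hamming distance. For a code $C$, $C_i$ is the set of vertices at distance exactly $i$ from $C$ (distance to the nearest codeword), and the covering radius $\rho$ is the maximal such distance. $C$ is completely transitive if there is a group $X$ of automorphisms of $H(m,q)$ such that every $C_i$, $0\leq i\leq\rho$, is an $X$-orbit. $\mathrm{Rep}(m,q)=\{(a,\ldots,a):a\in Q\}$; for $Q=\{0,1\}$, $W([m/2],2)$ is the set of vertices with exactly $(m-1)/2$ or $(m+1)/2$ entries equal to $1$; $\mathrm{All}(pq,q)$ is the set of vertices of $H(pq,q)$ in which every letter occurs exactly $p$ times. -}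

module Defs where

open import Data.Nat using (ℕ; zero; suc; _+_; _*_; _≤_)
open import Data.Fin using (Fin; zero; suc)
open import Data.Fin.Properties using (_≟_)
open import Data.Vec using (Vec; []; _∷_; replicate)
open import Data.Sum using (_⊎_)
open import Data.Product using (Σ; ∃; _×_; _,_)
open import Relation.Nullary using (yes; no)
open import Relation.Binary.PropositionalEquality using (_≡_)
open import Function using (_∘_; _⇔_)
open import Level using (0ℓ) renaming (suc to lsuc)

Vertex : ℕ → ℕ → Set
Vertex m q = Vec (Fin q) m

hd : ∀ {m q} → Vertex m q → Vertex m q → ℕ
hd [] [] = 0
hd (a ∷ x) (b ∷ y) with a ≟ b
... | yes _ = hd x y
... | no  _ = suc (hd x y)

countOf : ∀ {m q} → Fin q → Vertex m q → ℕ
countOf a [] = 0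
countOf a (b ∷ x) with a ≟ b
... | yes _ = suc (countOf a x)
... | no  _ = countOf a x

Code : ℕ → ℕ → Set₁
Code m q = Vertex m q → Set

DistTo : ∀ {m q} → Code m q → Vertex m q → ℕ → Set
DistTo C x i = (∃ λ c → C c × hd x c ≡ i) × (∀ c → C c → i ≤ hd x c)

Layer : ∀ {m q} → Code m q → ℕ → Code m q
Layer C i x = DistTo C x i

CoveringRadius : ∀ {m q} → Code m q → ℕ → Set
CoveringRadius C ρ =
  (∀ x → ∃ λ i → i ≤ ρ × DistTo C x i) × (∃ λ x → DistTo C x ρ)

Adj : ∀ {m q} → Vertex m q → Vertex m q → Set
Adj x y = hd x y ≡ 1

record Aut (m q : ℕ) : Set where
  field
    fun     : Vertex m q → Vertex m q
    inv     : Vertex m q → Vertex m q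
    inv-l   : ∀ x → inv (fun x) ≡ x
    inv-r   : ∀ x → fun (inv x) ≡ x
    adj     : ∀ x y → Adj x y ⇔ Adj (fun x) (fun y)
open Aut public

IsAutGroup : ∀ {m q} → (Aut m q → Set) → Set
IsAutGroup {m} {q} X =
  (∃ λ e → X e × (∀ x → fun e x ≡ x)) ×
  (∀ g h → X g → X h → ∃ λ k → X k × (∀ x → fun k x ≡ fun g (fun h x))) ×
  (∀ g → X g → ∃ λ k → X k × (∀ x → fun k x ≡ inv g x))

IsOrbit : ∀ {m q} → (Aut m q → Set) → Code m q → Set
IsOrbit X S = ∃ λ x → ∀ y → S y ⇔ (∃ λ g → X g × fun g x ≡ y)

CompletelyTransitive : ∀ {m q} → Code m q → Set₁
CompletelyTransitive {m} {q} C =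
  ∃ λ ρ → CoveringRadius C ρ ×
    Σ (Aut m q → Set) λ X → IsAutGroup X × (∀ i → i ≤ ρ → IsOrbit X (Layer C i))

Rep : ∀ m q → Code m q
Rep m q x = ∃ λ a → x ≡ replicate m a

-- W([m/2],2) for odd m = 2k+1: words with exactly k = (m-1)/2 or k+1 = (m+1)/2 ones
-- (Q = Fin 2, the letter 1 is suc zero).
W : ∀ k → Code (suc (k + k)) 2
W k x = countOf (suc zero) x ≡ k ⊎ countOf (suc zero) x ≡ suc k

All : ∀ p q → Code (p * q) q
All p q x = ∀ (a : Fin q) → countOf a x ≡ p

_≐_ : ∀ {m q} → Code m q → Code m q → Set
C ≐ D = ∀ x → C x ⇔ D x

-- Part (i).  For a binary word x of length 2k + 1 let minCount x be the smaller of its numbers of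
-- zeros and ones.  A codeword of W has at least k copies of each letter, so counting the minority
-- letter of x gives d(x, W) ≥ k ∸ minCount x, with equality after turning k ∸ minCount x majority
-- letters into the minority letter; likewise d(x, Rep) = minCount x, so W's outermost layer is Rep.
-- Thus every layer of W and of Rep is a level set of minCount, and the automorphisms preserving
-- minCount, among them all coordinate permutations and the complement map, are transitive on
-- each level set.
-- Part (ii).  Refilling each block of q coordinates by a permutation of the alphabet that keeps
-- the block's first letter shows that every word lies within p(q − 1) of All(pq,q).  A word that
-- is not constant can be permuted so that its first block starts with two distinct letters, both
-- of which can then be kept, so only constant words are at distance p(q − 1); a constant word is
-- that far because each codeword contains its letter only p times.

module Submission where

open import Defs
open import Data.Nat using (ℕ; zero; suc; _+_; _*_; _∸_; _≤_; _<_; _⊓_; z≤n; s≤s)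
open import Data.Nat.Properties renaming (_≟_ to _≟ℕ_)
open import Algebra.Properties.CommutativeSemigroup +-commutativeSemigroup using (x∙yz≈y∙xz)
open import Data.Fin using (Fin; zero; suc)
open import Data.Fin.Properties using (_≟_; any?; all?)
open import Data.Vec using (Vec; []; _∷_; replicate; _++_; map; allFin; splitAt)
open import Data.Vec.Properties using (allFin-map)
open import Data.List using (List; []; _∷_; [_]) renaming (_++_ to _++ˡ_)
import Data.List as List
open import Data.Product using (∃; ∃₂; _×_; _,_)
open import Data.Sum using (_⊎_; inj₁; inj₂)
open import Data.Empty using (⊥-elim)
open import Function using (_⇔_; mk⇔; Equivalence)
import Function.Properties.Equivalence as ⇔
open import Relation.Nullary using (Dec; yes; no; contradiction)
open import Relation.Nullary.Decidable using (map′; _×-dec_)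
open import Relation.Binary.PropositionalEquality
  using (_≡_; _≢_; refl; sym; trans; cong; cong₂; subst; subst₂; module ≡-Reasoning)

open Equivalence using (to; from)

-- Hamming distance and letter counts

module _ {q : ℕ} where

  hd-refl : ∀ {m} (x : Vertex m q) → hd x x ≡ 0
  hd-refl [] = refl
  hd-refl (a ∷ x) with a ≟ a
  ... | yes _ = hd-refl x
  ... | no a≢a = ⊥-elim (a≢a refl)

  hd-sym : ∀ {m} (x y : Vertex m q) → hd x y ≡ hd y x
  hd-sym [] [] = refl
  hd-sym (a ∷ x) (b ∷ y) with a ≟ b | b ≟ a
  ... | yes _   | yes _   = hd-sym x y
  ... | no _    | no _    = cong suc (hd-sym x y)
  ... | yes a≡b | no b≢a  = ⊥-elim (b≢a (sym a≡b))
  ... | no a≢b  | yes b≡a = ⊥-elim (a≢b (sym b≡a))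

  hd≡0⇒≡ : ∀ {m} (x y : Vertex m q) → hd x y ≡ 0 → x ≡ y
  hd≡0⇒≡ [] [] _ = refl
  hd≡0⇒≡ (a ∷ x) (b ∷ y) h with a ≟ b
  ... | yes refl = cong (a ∷_) (hd≡0⇒≡ x y h)

  hd≤length : ∀ {m} (x y : Vertex m q) → hd x y ≤ m
  hd≤length [] [] = z≤n
  hd≤length (a ∷ x) (b ∷ y) with a ≟ b
  ... | yes _ = m≤n⇒m≤1+n (hd≤length x y)
  ... | no _  = s≤s (hd≤length x y)

  hd-∷ : ∀ {m} (a b : Fin q) (x y : Vertex m q) →
         hd (a ∷ x) (b ∷ y) ≡ hd (a ∷ []) (b ∷ []) + hd x y
  hd-∷ a b x y with a ≟ b
  ... | yes _ = refl
  ... | no _  = refl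

  hd-∷-same : ∀ {m} (a : Fin q) (x y : Vertex m q) → hd (a ∷ x) (a ∷ y) ≡ hd x y
  hd-∷-same a x y with a ≟ a
  ... | yes _ = refl
  ... | no a≢a = ⊥-elim (a≢a refl)

  hd-∷-≢ : ∀ {m} {a b : Fin q} (x y : Vertex m q) → a ≢ b → hd (a ∷ x) (b ∷ y) ≡ suc (hd x y)
  hd-∷-≢ {a = a} {b} x y a≢b with a ≟ b
  ... | yes a≡b = ⊥-elim (a≢b a≡b)
  ... | no _ = refl

  hd-++ : ∀ {m n} (x y : Vertex m q) (x′ y′ : Vertex n q) →
          hd (x ++ x′) (y ++ y′) ≡ hd x y + hd x′ y′
  hd-++ [] [] x′ y′ = refl
  hd-++ (a ∷ x) (b ∷ y) x′ y′ with a ≟ b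
  ... | yes _ = hd-++ x y x′ y′
  ... | no _  = cong suc (hd-++ x y x′ y′)

  countOf-∷ : ∀ {m} (a b : Fin q) (x : Vertex m q) →
              countOf a (b ∷ x) ≡ countOf a (b ∷ []) + countOf a x
  countOf-∷ a b x with a ≟ b
  ... | yes _ = refl
  ... | no _  = refl

  countOf-∷-same : ∀ {m} (a : Fin q) (x : Vertex m q) → countOf a (a ∷ x) ≡ suc (countOf a x)
  countOf-∷-same a x with a ≟ a
  ... | yes _ = refl
  ... | no a≢a = ⊥-elim (a≢a refl)

  countOf-∷-≢ : ∀ {m} {a b : Fin q} (x : Vertex m q) → a ≢ b → countOf a (b ∷ x) ≡ countOf a x
  countOf-∷-≢ {a = a} {b} x a≢b with a ≟ b
  ... | yes a≡b = ⊥-elim (a≢b a≡b)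
  ... | no _ = refl

  countOf-∷-≤ : ∀ {m} (a b : Fin q) (x : Vertex m q) → countOf a (b ∷ x) ≤ suc (countOf a x)
  countOf-∷-≤ a b x with a ≟ b
  ... | yes _ = ≤-refl
  ... | no _  = n≤1+n _

  countOf-≤-∷ : ∀ {m} (a b : Fin q) (x : Vertex m q) → countOf a x ≤ countOf a (b ∷ x)
  countOf-≤-∷ a b x with a ≟ b
  ... | yes _ = n≤1+n _
  ... | no _  = ≤-refl

  countOf-∷-cancel : ∀ {m} (a b : Fin q) (x y : Vertex m q) →
                     countOf a (b ∷ x) ≡ countOf a (b ∷ y) → countOf a x ≡ countOf a y
  countOf-∷-cancel a b x y e with a ≟ b
  ... | yes _ = suc-injective e
  ... | no _  = e

  countOf-++ : ∀ {m n} (a : Fin q) (x : Vertex m q) (y : Vertex n q) →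
               countOf a (x ++ y) ≡ countOf a x + countOf a y
  countOf-++ a [] y = refl
  countOf-++ a (b ∷ x) y with a ≟ b
  ... | yes _ = cong suc (countOf-++ a x y)
  ... | no _  = countOf-++ a x y

  countOf-replicate : ∀ n (a : Fin q) → countOf a (replicate n a) ≡ n
  countOf-replicate zero a = refl
  countOf-replicate (suc n) a with a ≟ a
  ... | yes _ = cong suc (countOf-replicate n a)
  ... | no a≢a = ⊥-elim (a≢a refl)

  countOf-replicate-≢ : ∀ n {a b : Fin q} → a ≢ b → countOf a (replicate n b) ≡ 0
  countOf-replicate-≢ zero    a≢b = refl
  countOf-replicate-≢ (suc n) a≢b =
    trans (countOf-∷-≢ (replicate n _) a≢b) (countOf-replicate-≢ n a≢b)

  countOf-∷-mono : ∀ {m n d} (a b : Fin q) {x : Vertex m q} {y : Vertex n q} →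
                   countOf a x ≤ countOf a y + d → countOf a (b ∷ x) ≤ countOf a (b ∷ y) + d
  countOf-∷-mono a b le with a ≟ b
  ... | yes _ = s≤s le
  ... | no _  = le

  countOf≤countOf+hd : ∀ {m} (a : Fin q) (x y : Vertex m q) → countOf a x ≤ countOf a y + hd x y
  countOf≤countOf+hd a [] [] = z≤n
  countOf≤countOf+hd a (b ∷ x) (c ∷ y) with b ≟ c
  ... | yes refl = countOf-∷-mono a b (countOf≤countOf+hd a x y)
  ... | no _ = begin
    countOf a (b ∷ x)                 ≤⟨ countOf-∷-≤ a b x ⟩
    suc (countOf a x)                 ≤⟨ s≤s (countOf≤countOf+hd a x y) ⟩
    suc (countOf a y + hd x y)        ≡⟨ +-suc (countOf a y) (hd x y) ⟨
    countOf a y + suc (hd x y)        ≤⟨ +-monoˡ-≤ (suc (hd x y)) (countOf-≤-∷ a c y) ⟩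
    countOf a (c ∷ y) + suc (hd x y)  ∎
    where open ≤-Reasoning

  increaseCountOf : ∀ {n} (a : Fin q) (x : Vertex n q) t → t + countOf a x ≤ n →
                    ∃ λ c → countOf a c ≡ t + countOf a x × hd x c ≡ t
  increaseCountOf a [] zero _ = [] , refl , refl
  increaseCountOf a (b ∷ x) t h with a ≟ b
  increaseCountOf {suc n} a (.a ∷ x) t h | yes refl
    with increaseCountOf a x t (≤-pred (subst (_≤ suc n) (+-suc t _) h))
  ... | c , ac≡ , hd≡t = a ∷ c , trans (countOf-∷-same a c) (trans (cong suc ac≡) (sym (+-suc t _))) ,
                          trans (hd-∷-same a x c) hd≡t
  increaseCountOf a (b ∷ x) zero    h | no a≢b = b ∷ x , countOf-∷-≢ x a≢b , hd-refl (b ∷ x)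
  increaseCountOf a (b ∷ x) (suc t) h | no a≢b with increaseCountOf a x t (≤-pred h)
  ... | c , ac≡ , hd≡t = a ∷ c , trans (countOf-∷-same a c) (cong suc ac≡) ,
                          trans (hd-∷-≢ x c (λ b≡a → a≢b (sym b≡a))) (cong suc hd≡t)

  raiseCountOf : ∀ {n} (a : Fin q) (x : Vertex n q) {t} → countOf a x ≤ t → t ≤ n →
                 ∃ λ c → countOf a c ≡ t × hd x c ≡ t ∸ countOf a x
  raiseCountOf a x {t} ax≤t t≤n
    with increaseCountOf a x (t ∸ countOf a x) (subst (_≤ _) (sym (m∸n+n≡m ax≤t)) t≤n)
  ... | c , ac≡ , hd≡ = c , trans ac≡ (m∸n+n≡m ax≤t) , hd≡

-- Coordinate permutations

module _ {A : Set} where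

  -- swap j exchanges positions j and j + 1; out of range it is the identity.
  swap : ∀ {n} → ℕ → Vec A n → Vec A n
  swap zero    (a ∷ b ∷ x) = b ∷ a ∷ x
  swap (suc j) (a ∷ x)     = a ∷ swap j x
  swap _       x           = x

  swap-involutive : ∀ {n} j (x : Vec A n) → swap j (swap j x) ≡ x
  swap-involutive zero    []          = refl
  swap-involutive zero    (a ∷ [])    = refl
  swap-involutive zero    (a ∷ b ∷ x) = refl
  swap-involutive (suc j) []          = refl
  swap-involutive (suc j) (a ∷ x)     = cong (a ∷_) (swap-involutive j x)

  permute : ∀ {n} → List ℕ → Vec A n → Vec A n
  permute []      x = x
  permute (j ∷ L) x = permute L (swap j x)

  unpermute : ∀ {n} → List ℕ → Vec A n → Vec A n
  unpermute []      x = x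
  unpermute (j ∷ L) x = swap j (unpermute L x)

  unpermute-permute : ∀ {n} L (x : Vec A n) → unpermute L (permute L x) ≡ x
  unpermute-permute []      x = refl
  unpermute-permute (j ∷ L) x = trans (cong (swap j) (unpermute-permute L (swap j x))) (swap-involutive j x)

  permute-unpermute : ∀ {n} L (x : Vec A n) → permute L (unpermute L x) ≡ x
  permute-unpermute []      x = refl
  permute-unpermute (j ∷ L) x =
    trans (cong (permute L) (swap-involutive j (unpermute L x))) (permute-unpermute L x)

  permute-++ : ∀ {n} L L′ (x : Vec A n) → permute (L ++ˡ L′) x ≡ permute L′ (permute L x)
  permute-++ []      L′ x = refl
  permute-++ (j ∷ L) L′ x = permute-++ L L′ (swap j x)

  permute-tail : ∀ {n} L (a : A) (x : Vec A n) → permute (List.map suc L) (a ∷ x) ≡ a ∷ permute L x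
  permute-tail []      a x = refl
  permute-tail (j ∷ L) a x = permute-tail L a (swap j x)

  permute-behind : ∀ {n} L {a b : A} {x : Vec A (suc n)} {x′ : Vec A n} → permute L x ≡ b ∷ x′ →
                   permute (List.map suc L ++ˡ [ 0 ]) (a ∷ x) ≡ b ∷ a ∷ x′
  permute-behind L {a} {x = x} e = trans (permute-++ (List.map suc L) [ 0 ] (a ∷ x))
                                         (cong (swap 0) (trans (permute-tail L a x) (cong (a ∷_) e)))

module _ {q : ℕ} where

  hd-swap : ∀ {n} j (x y : Vertex n q) → hd (swap j x) (swap j y) ≡ hd x y
  hd-swap zero    (a ∷ a′ ∷ x) (b ∷ b′ ∷ y) = begin
    hd (a′ ∷ a ∷ x) (b′ ∷ b ∷ y)  ≡⟨ hd-∷ a′ b′ _ _ ⟩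
    d′ + hd (a ∷ x) (b ∷ y)       ≡⟨ cong (d′ +_) (hd-∷ a b x y) ⟩
    d′ + (d + hd x y)             ≡⟨ x∙yz≈y∙xz d′ d (hd x y) ⟩
    d + (d′ + hd x y)             ≡⟨ cong (d +_) (hd-∷ a′ b′ x y) ⟨
    d + hd (a′ ∷ x) (b′ ∷ y)      ≡⟨ hd-∷ a b _ _ ⟨
    hd (a ∷ a′ ∷ x) (b ∷ b′ ∷ y)  ∎
    where
    open ≡-Reasoning
    d d′ : ℕ
    d  = hd (a ∷ []) (b ∷ [])
    d′ = hd (a′ ∷ []) (b′ ∷ [])
  hd-swap zero    []          []          = refl
  hd-swap zero    (a ∷ [])    (b ∷ [])    = refl
  hd-swap (suc j) []          []          = refl
  hd-swap (suc j) (a ∷ x)     (b ∷ y)     =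
    trans (hd-∷ a b _ _) (trans (cong (_ +_) (hd-swap j x y)) (sym (hd-∷ a b x y)))

  countOf-swap : ∀ {n} j (a : Fin q) (x : Vertex n q) → countOf a (swap j x) ≡ countOf a x
  countOf-swap zero a (b ∷ b′ ∷ x) = begin
    countOf a (b′ ∷ b ∷ x)   ≡⟨ countOf-∷ a b′ _ ⟩
    e′ + countOf a (b ∷ x)   ≡⟨ cong (e′ +_) (countOf-∷ a b x) ⟩
    e′ + (e + countOf a x)   ≡⟨ x∙yz≈y∙xz e′ e (countOf a x) ⟩
    e + (e′ + countOf a x)   ≡⟨ cong (e +_) (countOf-∷ a b′ x) ⟨
    e + countOf a (b′ ∷ x)   ≡⟨ countOf-∷ a b _ ⟨
    countOf a (b ∷ b′ ∷ x)   ∎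
    where
    open ≡-Reasoning
    e e′ : ℕ
    e  = countOf a (b ∷ [])
    e′ = countOf a (b′ ∷ [])
  countOf-swap zero    a []       = refl
  countOf-swap zero    a (b ∷ []) = refl
  countOf-swap (suc j) a []       = refl
  countOf-swap (suc j) a (b ∷ x)  =
    trans (countOf-∷ a b _) (trans (cong (_ +_) (countOf-swap j a x)) (sym (countOf-∷ a b x)))

  hd-permute : ∀ {n} L (x y : Vertex n q) → hd (permute L x) (permute L y) ≡ hd x y
  hd-permute []      x y = refl
  hd-permute (j ∷ L) x y = trans (hd-permute L (swap j x) (swap j y)) (hd-swap j x y)

  countOf-permute : ∀ {n} L (a : Fin q) (x : Vertex n q) → countOf a (permute L x) ≡ countOf a x
  countOf-permute []      a x = refl
  countOf-permute (j ∷ L) a x = trans (countOf-permute L a (swap j x)) (countOf-swap j a x)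

  countOf-unpermute : ∀ {n} L (a : Fin q) (x : Vertex n q) → countOf a (unpermute L x) ≡ countOf a x
  countOf-unpermute L a x =
    trans (sym (countOf-permute L a (unpermute L x))) (cong (countOf a) (permute-unpermute L x))

  moveToFront : ∀ {n} (a : Fin q) (x : Vertex (suc n) q) → 1 ≤ countOf a x →
                ∃₂ λ L x′ → permute L x ≡ a ∷ x′
  moveToFront a (b ∷ x) h with a ≟ b
  moveToFront a (.a ∷ x)       h | yes refl = [] , x , refl
  moveToFront {zero}  a (b ∷ []) () | no _
  moveToFront {suc n} a (b ∷ x) h | no _ with moveToFront a x h
  ... | L , x′ , e = List.map suc L ++ˡ [ 0 ] , b ∷ x′ , permute-behind L e

  equalCounts⇒permutation : ∀ {n} (x y : Vertex n q) → (∀ a → countOf a x ≡ countOf a y) →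
                                ∃ λ L → permute L x ≡ y
  equalCounts⇒permutation [] [] _ = [] , refl
  equalCounts⇒permutation (c ∷ x) (b ∷ y) same
    with moveToFront b (c ∷ x) (subst (1 ≤_) (sym (trans (same b) (countOf-∷-same b y))) (s≤s z≤n))
  ... | L , x′ , e with equalCounts⇒permutation x′ y same′
    where
    same′ : ∀ a → countOf a x′ ≡ countOf a y
    same′ a = countOf-∷-cancel a b x′ y
      (trans (cong (countOf a) (sym e)) (trans (countOf-permute L a (c ∷ x)) (same a)))
  ... | L′ , e′ = L ++ˡ List.map suc L′ , (begin
    permute (L ++ˡ List.map suc L′) (c ∷ x)        ≡⟨ permute-++ L (List.map suc L′) (c ∷ x) ⟩
    permute (List.map suc L′) (permute L (c ∷ x))  ≡⟨ cong (permute (List.map suc L′)) e ⟩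
    permute (List.map suc L′) (b ∷ x′)             ≡⟨ permute-tail L′ b x′ ⟩
    b ∷ permute L′ x′                              ≡⟨ cong (b ∷_) e′ ⟩
    b ∷ y                                          ∎)
    where open ≡-Reasoning

  constant-or-otherToFront : ∀ {n} (a : Fin q) (x : Vertex (suc n) q) →
    x ≡ replicate (suc n) a ⊎ ∃ λ b → b ≢ a × ∃₂ λ L x′ → permute L x ≡ b ∷ x′
  constant-or-otherToFront a (b ∷ x) with b ≟ a
  ... | no b≢a = inj₂ (b , b≢a , [] , x , refl)
  constant-or-otherToFront         a (.a ∷ [])    | yes refl = inj₁ refl
  constant-or-otherToFront {suc n} a (.a ∷ x)     | yes refl with constant-or-otherToFront a x
  ... | inj₁ x≡aⁿ = inj₁ (cong (a ∷_) x≡aⁿ)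
  ... | inj₂ (b , b≢a , L , x′ , e) =
    inj₂ (b , b≢a , List.map suc L ++ˡ [ 0 ] , a ∷ x′ , permute-behind L e)

-- Automorphism groups and distances to codes

module _ {m q : ℕ} where

  isometryAut : (f g : Vertex m q → Vertex m q) → (∀ x → g (f x) ≡ x) → (∀ x → f (g x) ≡ x) →
                (∀ x y → hd (f x) (f y) ≡ hd x y) → Aut m q
  isometryAut f g gf fg iso = record
    { fun = f ; inv = g ; inv-l = gf ; inv-r = fg
    ; adj = λ x y → mk⇔ (trans (iso x y)) (trans (sym (iso x y))) }

  idAut : Aut m q
  idAut = isometryAut (λ x → x) (λ x → x) (λ _ → refl) (λ _ → refl) (λ _ _ → refl)

  _∘ᴬ_ : Aut m q → Aut m q → Aut m q
  g ∘ᴬ h = record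
    { fun = λ x → fun g (fun h x) ; inv = λ x → inv h (inv g x)
    ; inv-l = λ x → trans (cong (inv h) (inv-l g (fun h x))) (inv-l h x)
    ; inv-r = λ x → trans (cong (fun g) (inv-r h (inv g x))) (inv-r g x)
    ; adj = λ x y → ⇔.trans (adj h x y) (adj g (fun h x) (fun h y)) }

  invAut : Aut m q → Aut m q
  invAut g = record
    { fun = inv g ; inv = fun g ; inv-l = inv-r g ; inv-r = inv-l g
    ; adj = λ x y → ⇔.sym (⇔.trans (adj g (inv g x) (inv g y))
                                   (mk⇔ (subst₂ Adj (inv-r g x) (inv-r g y))
                                        (subst₂ Adj (sym (inv-r g x)) (sym (inv-r g y))))) }

  Preserving : (Vertex m q → ℕ) → Aut m q → Set
  Preserving ψ g = ∀ x → ψ (fun g x) ≡ ψ x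

  Preserving-isAutGroup : (ψ : Vertex m q → ℕ) → IsAutGroup (Preserving ψ)
  Preserving-isAutGroup ψ =
      (idAut , (λ _ → refl) , λ _ → refl)
    , (λ g h ψg ψh → g ∘ᴬ h , (λ x → trans (ψg (fun h x)) (ψh x)) , λ _ → refl)
    , (λ g ψg → invAut g , (λ x → trans (sym (ψg (inv g x))) (cong ψ (inv-r g x))) , λ _ → refl)

  LevelTransitive : (Vertex m q → ℕ) → Set
  LevelTransitive ψ = ∀ x y → ψ x ≡ ψ y → ∃ λ g → Preserving ψ g × fun g x ≡ y

  IsOrbit-cong : ∀ {X} {S T : Code m q} → S ≐ T → IsOrbit X S → IsOrbit X T
  IsOrbit-cong S≐T (x , orb) = x , λ y → ⇔.trans (⇔.sym (S≐T y)) (orb y)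

  levelSet-isOrbit : (ψ : Vertex m q → ℕ) → LevelTransitive ψ → ∀ {t} → (∃ λ x → ψ x ≡ t) →
                     IsOrbit (Preserving ψ) (λ x → ψ x ≡ t)
  levelSet-isOrbit ψ trans-ψ (x , ψx≡t) = x , λ y → mk⇔
    (λ ψy≡t → trans-ψ x y (trans ψx≡t (sym ψy≡t)))
    (λ { (g , ψg , refl) → trans (ψg x) ψx≡t })

  DistTo-unique : ∀ {C : Code m q} {x i j} → DistTo C x i → DistTo C x j → i ≡ j
  DistTo-unique ((c , Cc , refl) , i≤) ((c′ , Cc′ , refl) , j≤) = ≤-antisym (i≤ c′ Cc′) (j≤ c Cc)

  DistTo-cong : ∀ {C D : Code m q} → C ≐ D → ∀ {x i} → DistTo C x i → DistTo D x i
  DistTo-cong C≐D ((c , Cc , e) , i≤) =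
    (c , to (C≐D c) Cc , e) , λ c′ Dc′ → i≤ c′ (from (C≐D c′) Dc′)

  DistTo-formula : ∀ {C : Code m q} {f : Vertex m q → ℕ} → (∀ x → DistTo C x (f x)) →
                   ∀ i → Layer C i ≐ λ x → f x ≡ i
  DistTo-formula dist i x = mk⇔ (λ d → DistTo-unique {x = x} (dist x) d) (λ { refl → dist x })

  ∈⇔DistTo-0 : ∀ {C : Code m q} {x i} → DistTo C x i → C x ⇔ i ≡ 0
  ∈⇔DistTo-0 {x = x} ((c , Cc , hd≡i) , i≤) = mk⇔
    (λ Cx → ≤-antisym (subst (_ ≤_) (hd-refl x) (i≤ x Cx)) z≤n)
    (λ { refl → subst _ (sym (hd≡0⇒≡ x c hd≡i)) Cc })

  coveringRadius-byFormula : ∀ {C : Code m q} {f : Vertex m q → ℕ} {ρ} → (∀ x → DistTo C x (f x)) →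
                             (∀ x → f x ≤ ρ) → (∃ λ x → f x ≡ ρ) → CoveringRadius C ρ
  coveringRadius-byFormula dist f≤ρ (x , refl) = (λ y → _ , f≤ρ y , dist y) , x , dist x

  completelyTransitive-byLevels : ∀ {C : Code m q} {ρ} (ψ : Vertex m q → ℕ) → LevelTransitive ψ →
    CoveringRadius C ρ →
    (∀ i → i ≤ ρ → ∃ λ t → (∃ λ x → ψ x ≡ t) × (Layer C i ≐ λ x → ψ x ≡ t)) →
    CompletelyTransitive C
  completelyTransitive-byLevels ψ trans-ψ radius levels =
    _ , radius , Preserving ψ , Preserving-isAutGroup ψ ,
    λ i i≤ρ → let (t , inhabited , layer≐) = levels i i≤ρ in
      IsOrbit-cong (λ x → ⇔.sym (layer≐ x)) (levelSet-isOrbit ψ trans-ψ inhabited)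

module _ {q : ℕ} where

  any-vertex? : ∀ {m} {P : Vertex m q → Set} → (∀ x → Dec (P x)) → Dec (∃ P)
  any-vertex? {zero}  P? = map′ (λ p → [] , p) (λ { ([] , p) → p }) (P? [])
  any-vertex? {suc m} P? = map′ (λ { (a , x , p) → a ∷ x , p }) (λ { (a ∷ x , p) → a , x , p })
                                (any? λ a → any-vertex? λ x → P? (a ∷ x))

  nearest : ∀ {m} {C : Code m q} → (∀ c → Dec (C c)) → ∀ x c → C c →
            ∃ λ i → i ≤ hd x c × DistTo C x i
  nearest {C = C} C? x c Cc = search (hd x c) c Cc ≤-refl
    where
    search : ∀ d c → C c → hd x c ≤ d → ∃ λ i → i ≤ hd x c × DistTo C x i
    search d c Cc hc≤d with any-vertex? (λ c′ → C? c′ ×-dec (hd x c′ <? hd x c))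
    ... | no none =
      hd x c , ≤-refl , (c , Cc , refl) , λ c′ Cc′ → ≮⇒≥ (λ lt → none (c′ , Cc′ , lt))
    search zero    c Cc hc≤0 | yes (c′ , _ , lt) = ⊥-elim (n≮0 (<-≤-trans lt hc≤0))
    search (suc d) c Cc hc≤d | yes (c′ , Cc′ , lt) =
      let (i , i≤ , dist) = search d c′ Cc′ (≤-pred (<-≤-trans lt hc≤d))
      in  i , ≤-trans i≤ (<⇒≤ lt) , dist

-- Binary words

flip : Fin 2 → Fin 2
flip zero       = suc zero
flip (suc zero) = zero

≢⇒≡flip : {a b : Fin 2} → a ≢ b → a ≡ flip b
≢⇒≡flip {zero}     {zero}     a≢b = contradiction refl a≢b
≢⇒≡flip {zero}     {suc zero} _   = refl
≢⇒≡flip {suc zero} {zero}     _   = refl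
≢⇒≡flip {suc zero} {suc zero} a≢b = contradiction refl a≢b

flip-involutive : ∀ a → flip (flip a) ≡ a
flip-involutive zero       = refl
flip-involutive (suc zero) = refl

complement : ∀ {n} → Vertex n 2 → Vertex n 2
complement = map flip

minCount : ∀ {n} → Vertex n 2 → ℕ
minCount x = countOf zero x ⊓ countOf (suc zero) x

countOf+countOf-flip : ∀ {n} (a : Fin 2) (x : Vertex n 2) → countOf a x + countOf (flip a) x ≡ n
countOf+countOf-flip a          []               = refl
countOf+countOf-flip zero       (zero ∷ x)       = cong suc (countOf+countOf-flip zero x)
countOf+countOf-flip zero       (suc zero ∷ x)   =
  trans (+-suc _ _) (cong suc (countOf+countOf-flip zero x))
countOf+countOf-flip (suc zero) (zero ∷ x)       =
  trans (+-suc _ _) (cong suc (countOf+countOf-flip (suc zero) x))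
countOf+countOf-flip (suc zero) (suc zero ∷ x)   = cong suc (countOf+countOf-flip (suc zero) x)

equalCount⇒equalCounts : ∀ {n} (a : Fin 2) (x y : Vertex n 2) → countOf a x ≡ countOf a y →
                         ∀ c → countOf c x ≡ countOf c y
equalCount⇒equalCounts a x y e c with c ≟ a
... | yes refl = e
... | no c≢a rewrite ≢⇒≡flip c≢a = +-cancelˡ-≡ (countOf a x) _ _
  (trans (countOf+countOf-flip a x) (sym (trans (cong (_+ _) e) (countOf+countOf-flip a y))))

hd-replicate : ∀ {n} (x : Vertex n 2) (a : Fin 2) → hd x (replicate n a) ≡ countOf (flip a) x
hd-replicate []             a          = refl
hd-replicate (zero ∷ x)     zero       = hd-replicate x zero
hd-replicate (zero ∷ x)     (suc zero) = cong suc (hd-replicate x (suc zero))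
hd-replicate (suc zero ∷ x) zero       = cong suc (hd-replicate x zero)
hd-replicate (suc zero ∷ x) (suc zero) = hd-replicate x (suc zero)

complement-involutive : ∀ {n} (x : Vertex n 2) → complement (complement x) ≡ x
complement-involutive []             = refl
complement-involutive (zero ∷ x)     = cong (zero ∷_) (complement-involutive x)
complement-involutive (suc zero ∷ x) = cong (suc zero ∷_) (complement-involutive x)

hd-complement : ∀ {n} (x y : Vertex n 2) → hd (complement x) (complement y) ≡ hd x y
hd-complement []             []             = refl
hd-complement (zero ∷ x)     (zero ∷ y)     = hd-complement x y
hd-complement (zero ∷ x)     (suc zero ∷ y) = cong suc (hd-complement x y)
hd-complement (suc zero ∷ x) (zero ∷ y)     = cong suc (hd-complement x y)
hd-complement (suc zero ∷ x) (suc zero ∷ y) = hd-complement x y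

countOf-complement : ∀ {n} (a : Fin 2) (x : Vertex n 2) → countOf a (complement x) ≡ countOf (flip a) x
countOf-complement a          []             = refl
countOf-complement zero       (zero ∷ x)     = countOf-complement zero x
countOf-complement zero       (suc zero ∷ x) = cong suc (countOf-complement zero x)
countOf-complement (suc zero) (zero ∷ x)     = cong suc (countOf-complement (suc zero) x)
countOf-complement (suc zero) (suc zero ∷ x) = countOf-complement (suc zero) x

minCount≤countOf : ∀ {n} (x : Vertex n 2) a → minCount x ≤ countOf a x
minCount≤countOf x zero       = m⊓n≤m _ _
minCount≤countOf x (suc zero) = m⊓n≤n _ _

minCount-attained : ∀ {n} (x : Vertex n 2) → ∃ λ a → countOf a x ≡ minCount x
minCount-attained x with ⊓-sel (countOf zero x) (countOf (suc zero) x)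
... | inj₁ e = zero , sym e
... | inj₂ e = suc zero , sym e

minCount-complement : ∀ {n} (x : Vertex n 2) → minCount (complement x) ≡ minCount x
minCount-complement x = trans (cong₂ _⊓_ (countOf-complement zero x) (countOf-complement (suc zero) x))
                              (⊓-comm _ _)

minCount-permute : ∀ {n} L (x : Vertex n 2) → minCount (permute L x) ≡ minCount x
minCount-permute L x = cong₂ _⊓_ (countOf-permute L zero x) (countOf-permute L (suc zero) x)

module _ {n : ℕ} where

  permutationAut : List ℕ → Aut n 2
  permutationAut L =
    isometryAut (permute L) (unpermute L) (unpermute-permute L) (permute-unpermute L) (hd-permute L)

  complementAut : Aut n 2
  complementAut = isometryAut complement complement complement-involutive complement-involutive hd-complement

  equalCount⇒permutationAut : ∀ a (x y : Vertex n 2) → countOf a x ≡ countOf a y →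
                              ∃ λ g → Preserving minCount g × fun g x ≡ y
  equalCount⇒permutationAut a x y e =
    let (L , Lx≡y) = equalCounts⇒permutation x y (equalCount⇒equalCounts a x y e)
    in permutationAut L , minCount-permute L , Lx≡y

  minCount-levelTransitive : LevelTransitive (minCount {n})
  minCount-levelTransitive x y e with minCount-attained x | minCount-attained y
  ... | a , ax≡min | b , by≡min with a ≟ b
  ... | yes refl = equalCount⇒permutationAut a x y (trans ax≡min (trans e (sym by≡min)))
  ... | no a≢b =
    let (g , g-pres , gx̄≡y) = equalCount⇒permutationAut b (complement x) y bx̄≡by
    in g ∘ᴬ complementAut , (λ z → trans (g-pres (complement z)) (minCount-complement z)) , gx̄≡y
    where
    bx̄≡by : countOf b (complement x) ≡ countOf b y
    bx̄≡by = begin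
      countOf b (complement x)  ≡⟨ countOf-complement b x ⟩
      countOf (flip b) x        ≡⟨ cong (λ c → countOf c x) (sym (≢⇒≡flip a≢b)) ⟩
      countOf a x               ≡⟨ trans ax≡min (trans e (sym by≡min)) ⟩
      countOf b y               ∎
      where open ≡-Reasoning

DistTo-Rep : ∀ {n} (x : Vertex n 2) → DistTo (Rep n 2) x (minCount x)
DistTo-Rep {n} x =
  let (a , ax≡min) = minCount-attained x in
  ( replicate n (flip a) , (flip a , refl)
  , trans (hd-replicate x (flip a)) (trans (cong (λ b → countOf b x) (flip-involutive a)) ax≡min))
  , λ { _ (b , refl) → subst (minCount x ≤_) (sym (hd-replicate x b)) (minCount≤countOf x (flip b)) }

-- The code W([m/2],2), m = 2k + 1

half-≤ : ∀ m k → m + m ≤ suc (k + k) → m ≤ k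
half-≤ zero    k       _       = z≤n
half-≤ (suc m) zero    (s≤s h) = contradiction (subst (_≤ 0) (+-suc m m) h) λ ()
half-≤ (suc m) (suc k) (s≤s h) =
  s≤s (half-≤ m k (≤-pred (subst₂ _≤_ (+-suc m m) (cong suc (+-suc k k)) h)))

∸-flip : ∀ {k v i} → v ≤ k → k ∸ v ≡ i → k ∸ i ≡ v
∸-flip v≤k refl = m∸[m∸n]≡n v≤k

module _ (k : ℕ) where

  W⇒k≤countOf : ∀ {c} → W k c → ∀ a → k ≤ countOf a c
  W⇒k≤countOf (inj₁ ones≡k)  (suc zero) = ≤-reflexive (sym ones≡k)
  W⇒k≤countOf (inj₂ ones≡1+k) (suc zero) = subst (k ≤_) (sym ones≡1+k) (n≤1+n k)
  W⇒k≤countOf {c} W-c zero = +-cancelʳ-≤ (suc k) k (countOf zero c) (begin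
    k + suc k                                ≡⟨ +-suc k k ⟩
    suc (k + k)                              ≡⟨ countOf+countOf-flip zero c ⟨
    countOf zero c + countOf (suc zero) c    ≤⟨ +-monoʳ-≤ (countOf zero c) (ones≤1+k W-c) ⟩
    countOf zero c + suc k                   ∎)
    where
    open ≤-Reasoning
    ones≤1+k : W k c → countOf (suc zero) c ≤ suc k
    ones≤1+k (inj₁ ones≡k)  = subst (_≤ suc k) (sym ones≡k) (n≤1+n k)
    ones≤1+k (inj₂ ones≡1+k) = ≤-reflexive ones≡1+k

  countOf≡k⇒W : ∀ {c} a → countOf a c ≡ k → W k c
  countOf≡k⇒W (suc zero) ones≡k = inj₁ ones≡k
  countOf≡k⇒W {c} zero zeros≡k = inj₂ (+-cancelˡ-≡ k _ _ (begin
    k + countOf (suc zero) c                 ≡⟨ cong (_+ countOf (suc zero) c) zeros≡k ⟨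
    countOf zero c + countOf (suc zero) c    ≡⟨ countOf+countOf-flip zero c ⟩
    suc (k + k)                              ≡⟨ +-suc k k ⟨
    k + suc k                                ∎))
    where open ≡-Reasoning

  minCount≤k : (x : Vertex (suc (k + k)) 2) → minCount x ≤ k
  minCount≤k x = half-≤ (minCount x) k (begin
    minCount x + minCount x
      ≤⟨ +-mono-≤ (minCount≤countOf x zero) (minCount≤countOf x (suc zero)) ⟩
    countOf zero x + countOf (suc zero) x    ≡⟨ countOf+countOf-flip zero x ⟩
    suc (k + k)                              ∎)
    where open ≤-Reasoning

  DistTo-W : (x : Vertex (suc (k + k)) 2) → DistTo (W k) x (k ∸ minCount x)
  DistTo-W x = let (a , ax≡min) = minCount-attained x in viaMinority a ax≡min
    where
    viaMinority : ∀ a → countOf a x ≡ minCount x → DistTo (W k) x (k ∸ minCount x)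
    viaMinority a ax≡min
      with raiseCountOf a x (subst (_≤ k) (sym ax≡min) (minCount≤k x))
                            (≤-trans (m≤m+n k k) (n≤1+n (k + k)))
    ... | c , ac≡k , hd≡ =
      (c , countOf≡k⇒W {c} a ac≡k , trans hd≡ (cong (k ∸_) ax≡min)) ,
      λ c′ W-c′ → m≤n+o⇒m∸n≤o k (minCount x) (begin
        k                       ≤⟨ W⇒k≤countOf {c′} W-c′ a ⟩
        countOf a c′            ≤⟨ countOf≤countOf+hd a c′ x ⟩
        countOf a x + hd c′ x   ≡⟨ cong₂ _+_ ax≡min (hd-sym c′ x) ⟩
        minCount x + hd x c′    ∎)
      where open ≤-Reasoning

  minCount-onto : ∀ {t} → t ≤ k → ∃ λ (x : Vertex (suc (k + k)) 2) → minCount x ≡ t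
  minCount-onto {t} t≤k
    with raiseCountOf (suc zero) (replicate (suc (k + k)) zero)
           (subst (_≤ t) (sym (countOf-replicate-≢ (suc (k + k)) {suc zero} {zero} λ ())) z≤n)
           (≤-trans t≤k (≤-trans (m≤m+n k k) (n≤1+n (k + k))))
  ... | c , ones≡t , _ = c , trans (m≥n⇒m⊓n≡n ones≤zeros) ones≡t
    where
    open ≤-Reasoning
    ones≤zeros : countOf (suc zero) c ≤ countOf zero c
    ones≤zeros = subst (_≤ countOf zero c) (sym ones≡t) (+-cancelʳ-≤ t t (countOf zero c) (begin
      t + t                                    ≤⟨ +-mono-≤ t≤k t≤k ⟩
      k + k                                    ≤⟨ n≤1+n (k + k) ⟩
      suc (k + k)                              ≡⟨ countOf+countOf-flip zero c ⟨
      countOf zero c + countOf (suc zero) c    ≡⟨ cong (countOf zero c +_) ones≡t ⟩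
      countOf zero c + t                       ∎))

  W-layer : ∀ i → i ≤ k → Layer (W k) i ≐ λ x → minCount x ≡ k ∸ i
  W-layer i i≤k x = ⇔.trans (DistTo-formula DistTo-W i x)
    (mk⇔ (λ e → sym (∸-flip (minCount≤k x) e)) (λ e → ∸-flip i≤k (sym e)))

  W-coveringRadius : CoveringRadius (W k) k
  W-coveringRadius = coveringRadius-byFormula DistTo-W (λ x → m∸n≤m k (minCount x))
    (let (x , min≡0) = minCount-onto z≤n in x , cong (k ∸_) min≡0)

  W-completelyTransitive : CompletelyTransitive (W k)
  W-completelyTransitive = completelyTransitive-byLevels minCount minCount-levelTransitive W-coveringRadius
    λ i i≤k → k ∸ i , minCount-onto (m∸n≤m k i) , W-layer i i≤k

  Wₖ≐Rep : Layer (W k) k ≐ Rep (suc (k + k)) 2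
  Wₖ≐Rep x = ⇔.trans (W-layer k ≤-refl x)
    (subst (λ t → (minCount x ≡ t) ⇔ Rep _ 2 x) (sym (n∸n≡0 k))
           (⇔.sym (∈⇔DistTo-0 (DistTo-Rep x))))

  DistTo-Wₖ : (x : Vertex (suc (k + k)) 2) → DistTo (Layer (W k) k) x (minCount x)
  DistTo-Wₖ x = DistTo-cong (λ c → ⇔.sym (Wₖ≐Rep c)) {x} (DistTo-Rep x)

  Wₖ-completelyTransitive : CompletelyTransitive (Layer (W k) k)
  Wₖ-completelyTransitive = completelyTransitive-byLevels minCount minCount-levelTransitive
    (coveringRadius-byFormula DistTo-Wₖ minCount≤k (minCount-onto ≤-refl))
    λ i i≤k → i , minCount-onto i≤k , DistTo-formula DistTo-Wₖ i

-- The code All(pq,q)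

module _ {q : ℕ} where

  Rainbow : Vertex q q → Set
  Rainbow w = ∀ a → countOf a w ≡ 1

  Rainbow-permute : ∀ L {w} → Rainbow w → Rainbow (permute L w)
  Rainbow-permute L {w} rainbow a = trans (countOf-permute L a w) (rainbow a)

  All-++ : ∀ {p} {u : Vertex q q} {c : Vertex (p * q) q} →
           Rainbow u → All p q c → All (suc p) q (u ++ c)
  All-++ {u = u} {c} rainbow all a = trans (countOf-++ a u c) (cong₂ _+_ (rainbow a) (all a))

countOf-zero-map-suc : ∀ {n q} (v : Vertex n q) → countOf zero (map suc v) ≡ 0
countOf-zero-map-suc []      = refl
countOf-zero-map-suc (b ∷ v) = countOf-zero-map-suc v

countOf-suc-map-suc : ∀ {n q} (a : Fin q) (v : Vertex n q) → countOf (suc a) (map suc v) ≡ countOf a v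
countOf-suc-map-suc a []      = refl
countOf-suc-map-suc a (b ∷ v) with a ≟ b
... | yes _ = cong suc (countOf-suc-map-suc a v)
... | no _  = countOf-suc-map-suc a v

Rainbow-allFin : ∀ q → Rainbow (allFin q)
Rainbow-allFin (suc q) a = subst (λ v → countOf a v ≡ 1) (sym (allFin-map q)) (shifted a)
  where
  shifted : ∀ a → countOf a (zero ∷ map suc (allFin q)) ≡ 1
  shifted zero    = cong suc (countOf-zero-map-suc (allFin q))
  shifted (suc b) = trans (countOf-suc-map-suc b (allFin q)) (Rainbow-allFin q b)

module _ {q′ : ℕ} where

  rainbow-from : (a : Fin (suc q′)) → ∃ λ w → Rainbow (a ∷ w)
  rainbow-from a with moveToFront a (allFin (suc q′)) (subst (1 ≤_) (sym (Rainbow-allFin _ a)) ≤-refl)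
  ... | L , w , e = w , subst Rainbow e (Rainbow-permute L (Rainbow-allFin _))

  All-within : ∀ p (x : Vertex (p * suc q′) (suc q′)) →
               ∃ λ c → All p (suc q′) c × hd x c ≤ p * q′
  All-within zero    []  = [] , (λ _ → refl) , z≤n
  All-within (suc p) x with splitAt (suc q′) x
  ... | y₀ ∷ y , x′ , refl with rainbow-from y₀ | All-within p x′
  ... | w , rainbow | c′ , all′ , hd′≤ = (y₀ ∷ w) ++ c′ , All-++ rainbow all′ , (begin
    hd ((y₀ ∷ y) ++ x′) ((y₀ ∷ w) ++ c′)   ≡⟨ hd-++ (y₀ ∷ y) (y₀ ∷ w) x′ c′ ⟩
    hd (y₀ ∷ y) (y₀ ∷ w) + hd x′ c′        ≡⟨ cong (_+ hd x′ c′) (hd-∷-same y₀ y w) ⟩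
    hd y w + hd x′ c′                      ≤⟨ +-mono-≤ (hd≤length y w) hd′≤ ⟩
    q′ + p * q′                            ∎)
    where open ≤-Reasoning

  DistTo-replicate-All : ∀ p (a : Fin (suc q′)) →
                         DistTo (All p (suc q′)) (replicate (p * suc q′) a) (p * q′)
  DistTo-replicate-All p a with All-within p (replicate (p * suc q′) a)
  ... | c , all , hd≤ = (c , all , ≤-antisym hd≤ (far c all)) , far
    where
    aᵐ : Vertex (p * suc q′) (suc q′)
    aᵐ = replicate (p * suc q′) a
    far : ∀ c → All p (suc q′) c → p * q′ ≤ hd aᵐ c
    far c all = +-cancelˡ-≤ p _ _ (begin
      p + p * q′              ≡⟨ *-suc p q′ ⟨
      p * suc q′              ≡⟨ countOf-replicate (p * suc q′) a ⟨
      countOf a aᵐ            ≤⟨ countOf≤countOf+hd a aᵐ c ⟩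
      countOf a c + hd aᵐ c   ≡⟨ cong (_+ hd aᵐ c) (all a) ⟩
      p + hd aᵐ c             ∎)
      where open ≤-Reasoning

  All-coveringRadius : ∀ p → CoveringRadius (All p (suc q′)) (p * q′)
  All-coveringRadius p =
    (λ x → let (c₀ , all₀ , hd≤) = All-within p x
               (i , i≤ , dist) = nearest (λ c → all? λ a → countOf a c ≟ℕ p) x c₀ all₀
           in i , ≤-trans i≤ hd≤ , dist) ,
    replicate _ zero , DistTo-replicate-All p zero

module _ {q″ : ℕ} where

  rainbow-from₂ : ∀ {a b : Fin (suc (suc q″))} → a ≢ b → ∃ λ w → Rainbow (a ∷ b ∷ w)
  rainbow-from₂ {a} {b} a≢b with rainbow-from a
  ... | w₁ , rainbow₁ with moveToFront b w₁ (subst (1 ≤_) (sym b∈w₁) ≤-refl)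
    where
    b∈w₁ : countOf b w₁ ≡ 1
    b∈w₁ = trans (sym (countOf-∷-≢ w₁ (λ b≡a → a≢b (sym b≡a)))) (rainbow₁ b)
  ... | L , w₂ , e = w₂ , subst Rainbow (trans (permute-tail L a w₁) (cong (a ∷_) e))
                                        (Rainbow-permute (List.map suc L) rainbow₁)

  constant-or-closer : ∀ p (x : Vertex (suc p * suc (suc q″)) (suc (suc q″))) →
    Rep _ _ x ⊎ ∃ λ c → All (suc p) (suc (suc q″)) c × hd x c < suc p * suc q″
  constant-or-closer p (a ∷ x₁) with constant-or-otherToFront a x₁
  ... | inj₁ x₁≡aᵐ = inj₁ (a , cong (a ∷_) x₁≡aᵐ)
  ... | inj₂ (b , b≢a , L , x′ , e) with splitAt q″ x′
  ... | y , z , refl with rainbow-from₂ (λ a≡b → b≢a (sym a≡b)) | All-within p z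
  ... | w , rainbow | c′ , all′ , hd′≤ =
    inj₂ (unpermute M c₀ , all , s≤s (begin
      hd (a ∷ x₁) (unpermute M c₀)
        ≡⟨ hd-permute M (a ∷ x₁) (unpermute M c₀) ⟨
      hd (permute M (a ∷ x₁)) (permute M (unpermute M c₀))
        ≡⟨ cong₂ hd Mx≡ (permute-unpermute M c₀) ⟩
      hd (a ∷ b ∷ (y ++ z)) ((a ∷ b ∷ w) ++ c′)       ≡⟨ hd-∷-same a _ _ ⟩
      hd (b ∷ (y ++ z)) (b ∷ (w ++ c′))               ≡⟨ hd-∷-same b _ _ ⟩
      hd (y ++ z) (w ++ c′)                           ≡⟨ hd-++ y w z c′ ⟩
      hd y w + hd z c′                                ≤⟨ +-mono-≤ (hd≤length y w) hd′≤ ⟩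
      q″ + p * suc q″                                 ∎))
    where
    open ≤-Reasoning
    M : List ℕ
    M = List.map suc L
    c₀ : Vertex (suc p * suc (suc q″)) (suc (suc q″))
    c₀ = (a ∷ b ∷ w) ++ c′
    Mx≡ : permute M (a ∷ x₁) ≡ a ∷ b ∷ (y ++ z)
    Mx≡ = trans (permute-tail L a x₁) (cong (a ∷_) e)
    all : All (suc p) (suc (suc q″)) (unpermute M c₀)
    all d = trans (countOf-unpermute M d c₀) (All-++ rainbow all′ d)

  All-farthest≐Rep : ∀ p → Layer (All (suc p) (suc (suc q″))) (suc p * suc q″) ≐ Rep _ _
  All-farthest≐Rep p x = mk⇔ farthest⇒constant λ { (a , refl) → DistTo-replicate-All (suc p) a }
    where
    farthest⇒constant : DistTo (All (suc p) (suc (suc q″))) x (suc p * suc q″) → Rep _ _ x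
    farthest⇒constant (_ , ρ≤) with constant-or-closer p x
    ... | inj₁ constant = constant
    ... | inj₂ (c , all , closer) = contradiction (ρ≤ c all) (<⇒≱ closer)

corollary3p4 : (∀ (k : ℕ) → 1 ≤ k →
    CoveringRadius (W k) k × (Layer (W k) k ≐ Rep (suc (k + k)) 2)
    × CompletelyTransitive (W k) × CompletelyTransitive (Layer (W k) k))
    × (∀ (p q : ℕ) → 1 ≤ p → 2 ≤ q →
    CoveringRadius (All p q) (p * (q ∸ 1)) × (Layer (All p q) (p * (q ∸ 1)) ≐ Rep (p * q) q))
corollary3p4 =
    (λ k _ → W-coveringRadius k , Wₖ≐Rep k , W-completelyTransitive k , Wₖ-completelyTransitive k)
  , λ { (suc p) (suc (suc q″)) _ _ → All-coveringRadius (suc p) , All-farthest≐Rep p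
      ; (suc p) (suc zero) _ (s≤s ()) }
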